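{- Let $G=(V,E,s)$ be a directed graph with source $s$ in which every node is reachable from $s$. If $M$ and $H$ are overlapping modules of $G$ (that is, $M\cap H\neq\emptyset$, $M\not\subseteq H$ and $H\not\subseteq M$), then $M\cup H$ and $M\cap H$ are both modules of $G$.
   Context: A graph is a tuple $G=(V,E,s)$ with $V$ a finite set of nodes, $E\subseteq V\times V$ a set of arcs and $s\in V$ a distinguished source node; all nodes are assumed reachable from $s$. A module of $G$ is a set $M\subseteq V$ such that there exists $m\in M$ (the source of $M$) with the property that for every arc $(u,v)\in E$ with $u\notin M$ and $v\in M$ we have $v=m$ (all arcs entering $M$ from outside go to $m$). Convention: if $s\in M$, then $M$ is a module if and only if it is a module with source $s$ (one imagines an extra arc entering $s$ from outside $G$). -}

module Defs where

open import Data.Nat using (ℕ)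
open import Data.Fin using (Fin)
open import Data.Fin.Subset using (Subset; _∈_; _∉_; _⊆_; _∩_; _∪_; Nonempty)
open import Data.Product using (Σ; _×_; ∃)
open import Relation.Binary.PropositionalEquality using (_≡_)
open import Relation.Binary.Construct.Closure.ReflexiveTransitive using (Star)
open import Relation.Nullary using (¬_)

record Graph (n : ℕ) : Set₁ where
  field
    E : Fin n → Fin n → Set
    s : Fin n

open Graph public

AllReachable : ∀ {n} → Graph n → Set
AllReachable {n} G = ∀ (v : Fin n) → Star (E G) (s G) v

-- m is a source of M: m ∈ M, every arc entering M from outside goes to m,
-- and (convention) if s ∈ M then m = s (imagined extra arc entering s).
IsModuleWithSource : ∀ {n} → Graph n → Subset n → Fin n → Set
IsModuleWithSource {n} G M m =
  (m ∈ M) ×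
  ((∀ (u v : Fin n) → E G u v → u ∉ M → v ∈ M → v ≡ m) ×
   (s G ∈ M → m ≡ s G))

IsModule : ∀ {n} → Graph n → Subset n → Set
IsModule {n} G M = ∃ λ (m : Fin n) → IsModuleWithSource G M m

Overlapping : ∀ {n} → Subset n → Subset n → Set
Overlapping M H = Nonempty (M ∩ H) × (¬ (M ⊆ H)) × (¬ (H ⊆ M))

-- Sources are unique in an all-reachable graph: if s lies outside a module, a path from s into it
-- enters it along an arc whose head is every source of the module.
-- For modules M, H with sources m, h and M ∩ H ≠ ∅, a path from s into M ∩ H shows m ∈ H or h ∈ M, say h ∈ M. Then M ∪ H is a module with
-- source m; if also m ∈ H it is one with source h too, so m ≡ h. Hence every arc entering M ∩ H
-- ends in h.
module Submission where

open import Defs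
open import Data.Nat using (ℕ)
open import Data.Fin using (Fin)
open import Data.Fin.Subset using (Subset; _∈_; _∉_; _∩_; _∪_; Nonempty)
open import Data.Fin.Subset.Properties using (_∈?_; x∈p∪q⁺; x∈p∪q⁻; x∈p∩q⁺; x∈p∩q⁻; ∪-comm; ∩-comm)
open import Data.Product using (_×_; _,_; ∃₂; proj₂)
open import Data.Sum using (_⊎_; inj₁; inj₂)
open import Function using (_∘_)
open import Relation.Nullary using (yes; no; contradiction)
open import Relation.Binary.PropositionalEquality using (_≡_; refl; sym; trans; subst)
open import Relation.Binary.Construct.Closure.ReflexiveTransitive using (Star; ε; _◅_)

EnteringArc : ∀ {n} → (Fin n → Fin n → Set) → Subset n → Set
EnteringArc R S = ∃₂ λ u w → R u w × u ∉ S × w ∈ S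

Star⇒enteringArc : ∀ {n} {R : Fin n → Fin n → Set} (S : Subset n) {a b : Fin n} →
                   Star R a b → a ∉ S → b ∈ S → EnteringArc R S
Star⇒enteringArc S ε a∉S a∈S = contradiction a∈S a∉S
Star⇒enteringArc S {a} (_◅_ {j = c} a→c c→*b) a∉S b∈S with c ∈? S
... | yes c∈S = a , c , a→c , a∉S , c∈S
... | no c∉S = Star⇒enteringArc S c→*b c∉S b∈S

module _ {n : ℕ} {G : Graph n} where

  reachable⇒enteringArc : AllReachable G → ∀ {S : Subset n} {v : Fin n} →
                          v ∈ S → s G ∉ S → EnteringArc (E G) S
  reachable⇒enteringArc reach {S} {v} v∈S s∉S = Star⇒enteringArc S (reach v) s∉S v∈S

  source-unique : AllReachable G → ∀ {S : Subset n} {a b : Fin n} →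
                  IsModuleWithSource G S a → IsModuleWithSource G S b → a ≡ b
  source-unique reach {S} (a∈S , intoS-a , s-a) (_ , intoS-b , s-b) with s G ∈? S
  ... | yes s∈S = trans (s-a s∈S) (sym (s-b s∈S))
  ... | no s∉S with reachable⇒enteringArc reach a∈S s∉S
  ...   | u , w , u→w , u∉S , w∈S = trans (sym (intoS-a u w u→w u∉S w∈S)) (intoS-b u w u→w u∉S w∈S)

  module _ {M H : Subset n} {m h : Fin n} where

    ∪-source : IsModuleWithSource G M m → IsModuleWithSource G H h → h ∈ M →
               IsModuleWithSource G (M ∪ H) m
    ∪-source (m∈M , intoM , s∈M⇒m≡s) (_ , intoH , s∈H⇒h≡s) h∈M =
      x∈p∪q⁺ (inj₁ m∈M) , into , s∈M∪H⇒m≡s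
      where
      into : ∀ u v → E G u v → u ∉ M ∪ H → v ∈ M ∪ H → v ≡ m
      into u v u→v u∉M∪H v∈M∪H with x∈p∪q⁻ M H v∈M∪H
      ... | inj₁ v∈M = intoM u v u→v (u∉M∪H ∘ x∈p∪q⁺ ∘ inj₁) v∈M
      ... | inj₂ v∈H with intoH u v u→v (u∉M∪H ∘ x∈p∪q⁺ ∘ inj₂) v∈H
      ...   | refl = intoM u h u→v (u∉M∪H ∘ x∈p∪q⁺ ∘ inj₁) h∈M
      s∈M∪H⇒m≡s : s G ∈ M ∪ H → m ≡ s G
      s∈M∪H⇒m≡s s∈M∪H with x∈p∪q⁻ M H s∈M∪H
      ... | inj₁ s∈M = s∈M⇒m≡s s∈M
      ... | inj₂ s∈H = s∈M⇒m≡s (subst (_∈ M) (s∈H⇒h≡s s∈H) h∈M)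

    ∩-source : IsModuleWithSource G M m → IsModuleWithSource G H h → h ∈ M →
               (m ∈ H → m ≡ h) → IsModuleWithSource G (M ∩ H) h
    ∩-source (_ , intoM , _) (h∈H , intoH , s∈H⇒h≡s) h∈M m∈H⇒m≡h =
      x∈p∩q⁺ (h∈M , h∈H) , into , s∈H⇒h≡s ∘ proj₂ ∘ x∈p∩q⁻ M H
      where
      into : ∀ u v → E G u v → u ∉ M ∩ H → v ∈ M ∩ H → v ≡ h
      into u v u→v u∉M∩H v∈M∩H with x∈p∩q⁻ M H v∈M∩H | u ∈? M
      ... | v∈M , v∈H | no u∉M with intoM u v u→v u∉M v∈M
      ...   | refl = m∈H⇒m≡h v∈H
      into u v u→v u∉M∩H v∈M∩H | _ , v∈H | yes u∈M =
        intoH u v u→v (u∉M∩H ∘ x∈p∩q⁺ ∘ (u∈M ,_)) v∈H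

    sources-cross : AllReachable G → IsModuleWithSource G M m → IsModuleWithSource G H h →
                    Nonempty (M ∩ H) → m ∈ H ⊎ h ∈ M
    sources-cross reach (_ , intoM , s∈M⇒m≡s) (_ , intoH , _) (x , x∈M∩H) with m ∈? H
    ... | yes m∈H = inj₁ m∈H
    ... | no m∉H with reachable⇒enteringArc reach x∈M∩H (m∉H ∘ s∈M∩H⇒m∈H)
      where
      s∈M∩H⇒m∈H : s G ∈ M ∩ H → m ∈ H
      s∈M∩H⇒m∈H s∈M∩H with x∈p∩q⁻ M H s∈M∩H
      ... | s∈M , s∈H = subst (_∈ H) (sym (s∈M⇒m≡s s∈M)) s∈H
    ...   | u , w , u→w , u∉M∩H , w∈M∩H with x∈p∩q⁻ M H w∈M∩H | u ∈? M
    ...     | w∈M , w∈H | no u∉M =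
      contradiction (subst (_∈ H) (intoM u w u→w u∉M w∈M) w∈H) m∉H
    ...     | w∈M , w∈H | yes u∈M =
      inj₂ (subst (_∈ M) (intoH u w u→w (u∉M∩H ∘ x∈p∩q⁺ ∘ (u∈M ,_)) w∈H) w∈M)

  ∪-∩-modules : AllReachable G → ∀ {M H : Subset n} {m h : Fin n} →
                IsModuleWithSource G M m → IsModuleWithSource G H h → h ∈ M →
                IsModule G (M ∪ H) × IsModule G (M ∩ H)
  ∪-∩-modules reach {M} {H} {m} {h} M-m H-h h∈M =
    (m , ∪-source M-m H-h h∈M) , (h , ∩-source M-m H-h h∈M m∈H⇒m≡h)
    where
    m∈H⇒m≡h : m ∈ H → m ≡ h
    m∈H⇒m≡h m∈H = source-unique reach (∪-source M-m H-h h∈M)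
                    (subst (λ S → IsModuleWithSource G S h) (∪-comm H M) (∪-source H-h M-m m∈H))

lemma2 : ∀ (n : ℕ) (G : Graph n) → AllReachable G →
         ∀ (M H : Subset n) → IsModule G M → IsModule G H → Overlapping M H →
         IsModule G (M ∪ H) × IsModule G (M ∩ H)
lemma2 n G reach M H (m , M-m) (h , H-h) (M∩H≠∅ , _) with sources-cross reach M-m H-h M∩H≠∅
... | inj₂ h∈M = ∪-∩-modules reach M-m H-h h∈M
... | inj₁ m∈H with ∪-∩-modules reach H-h M-m m∈H
...   | H∪M , H∩M = subst (IsModule G) (∪-comm H M) H∪M , subst (IsModule G) (∩-comm H M) H∩M
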